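{- Let $n\ge 1$, let $B=(b_{ij})$ be a real $n\times n$ matrix with $b_{ij}\ge 0$ for all $i,j$ and $b_{ii}=0$, let $c\in\mathbb{R}^n$ and $X\subseteq\{0,1\}^n$. Let $\overline{X}$ satisfy $X\subseteq\overline{X}\subseteq[0,1]^n$, and for $i=1,\dots,n$ let $v_i=\max\{\sum_{j\neq i}b_{ij}x_j : x\in\overline{X},\ x_i=0\}$ and $l_i=\min\{\sum_{j\neq i}b_{ij}x_j : x\in\overline{X},\ x_i=1\}$. Consider (P): minimize $x^TBx+c^Tx$ subject to $x\in X$; (PL$_2$): minimize $\sum_{i=1}^n (y_i+c_ix_i)$ over $(x,y)\in X\times\mathbb{R}^n$ subject to $y_i\ge\sum_{j\neq i}b_{ij}x_j+v_ix_i-v_i$ and $y_i\ge l_ix_i$ for $i=1,\dots,n$; (PL$_2'$): minimize $\sum_{i=1}^n (t_i+(l_i+c_i)x_i)$ over $(x,t)\in X\times\mathbb{R}^n$ subject to $t_i\ge\sum_{j\neq i}b_{ij}x_j+(v_i-l_i)x_i-v_i$ and $t_i\ge 0$ for $i=1,\dots,n$. Then (PL$_2$) (and likewise (PL$_2'$)) and (P) are equivalent in the sense that for each optimal solution to one problem, there exists an optimal solution to the other problem having the same optimal objective value.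
   Context: $\overline{X}$ is a relaxation of $X$; it is assumed that for each $i$ the sets $\{x\in\overline{X}: x_i=0\}$ and $\{x\in\overline{X}: x_i=1\}$ are nonempty and the maxima and minima defining $v_i,l_i$ are attained. -}

module Defs where

open import Level using (Level; _⊔_) renaming (suc to lsuc)
open import Data.Nat using (ℕ)
import Data.Nat as ℕ
open import Data.Fin using (Fin; _≟_)
import Data.Fin as Fin
open import Data.Bool using (Bool; true; false; if_then_else_)
open import Data.Product using (Σ; _×_; _,_; ∃)
open import Relation.Nullary.Decidable using (⌊_⌋)
open import Relation.Binary using (Rel; IsTotalOrder)
open import Algebra.Bundles using (CommutativeRing)

-- The paper works over ℝ; agda-stdlib has no reals, so the statement is
-- made for an arbitrary (totally) ordered commutative ring.
record OrderedCommRing (c ℓ₁ ℓ₂ : Level) : Set (lsuc (c ⊔ ℓ₁ ⊔ ℓ₂)) where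
  field
    commutativeRing : CommutativeRing c ℓ₁
  open CommutativeRing commutativeRing public
  infix 4 _≤_
  field
    _≤_          : Rel Carrier ℓ₂
    isTotalOrder : IsTotalOrder _≈_ _≤_
    +-mono-≤     : ∀ {x y} z → x ≤ y → x + z ≤ y + z
    *-nonneg     : ∀ {x y} → 0# ≤ x → 0# ≤ y → 0# ≤ x * y

module Problem {c ℓ₁ ℓ₂ : Level} (R : OrderedCommRing c ℓ₁ ℓ₂) where
  open OrderedCommRing R hiding (zero)

  ∑ : (n : ℕ) → (Fin n → Carrier) → Carrier
  ∑ ℕ.zero    f = 0#
  ∑ (ℕ.suc n) f = f Fin.zero + ∑ n (λ j → f (Fin.suc j))

  ∑≠ : {n : ℕ} → Fin n → (Fin n → Carrier) → Carrier
  ∑≠ {n} i f = ∑ n (λ j → if ⌊ j ≟ i ⌋ then 0# else f j)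

  embed : {n : ℕ} → (Fin n → Bool) → Fin n → Carrier
  embed x i = if x i then 1# else 0#

  InUnitBox : {n : ℕ} → (Fin n → Carrier) → Set ℓ₂
  InUnitBox {n} x = ∀ i → (0# ≤ x i) × (x i ≤ 1#)

  rowSum : {n : ℕ} → (Fin n → Fin n → Carrier) → (Fin n → Carrier) → Fin n → Carrier
  rowSum B x i = ∑≠ i (λ j → B i j * x j)

  IsMaxRow : {n : ℕ} {ℓ : Level} → ((Fin n → Carrier) → Set ℓ) →
             (Fin n → Fin n → Carrier) → Fin n → Carrier → Set (c ⊔ ℓ ⊔ ℓ₁ ⊔ ℓ₂)
  IsMaxRow Xbar B i v =
    (∃ λ x → Xbar x × (x i ≈ 0#) × (rowSum B x i ≈ v)) ×
    (∀ x → Xbar x → x i ≈ 0# → rowSum B x i ≤ v)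

  IsMinRow : {n : ℕ} {ℓ : Level} → ((Fin n → Carrier) → Set ℓ) →
             (Fin n → Fin n → Carrier) → Fin n → Carrier → Set (c ⊔ ℓ ⊔ ℓ₁ ⊔ ℓ₂)
  IsMinRow Xbar B i l =
    (∃ λ x → Xbar x × (x i ≈ 1#) × (rowSum B x i ≈ l)) ×
    (∀ x → Xbar x → x i ≈ 1# → l ≤ rowSum B x i)

  module Instance {n : ℕ} {ℓ : Level}
                  (B : Fin n → Fin n → Carrier) (cv : Fin n → Carrier)
                  (X : (Fin n → Bool) → Set ℓ)
                  (v l : Fin n → Carrier) where

    objP : (Fin n → Bool) → Carrier
    objP x = ∑ n (λ i → ∑ n (λ j → embed x i * B i j * embed x j))
           + ∑ n (λ i → cv i * embed x i)

    OptP : (Fin n → Bool) → Set (ℓ ⊔ ℓ₂)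
    OptP x = X x × (∀ x' → X x' → objP x ≤ objP x')

    FeasPL2 : (Fin n → Bool) → (Fin n → Carrier) → Set (ℓ ⊔ ℓ₂)
    FeasPL2 x y = X x × (∀ i →
        (rowSum B (embed x) i + v i * embed x i - v i ≤ y i) ×
        (l i * embed x i ≤ y i))

    objPL2 : (Fin n → Bool) → (Fin n → Carrier) → Carrier
    objPL2 x y = ∑ n (λ i → y i + cv i * embed x i)

    OptPL2 : (Fin n → Bool) → (Fin n → Carrier) → Set (c ⊔ ℓ ⊔ ℓ₂)
    OptPL2 x y = FeasPL2 x y ×
      (∀ x' y' → FeasPL2 x' y' → objPL2 x y ≤ objPL2 x' y')

    FeasPL2' : (Fin n → Bool) → (Fin n → Carrier) → Set (ℓ ⊔ ℓ₂)
    FeasPL2' x t = X x × (∀ i →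
        (rowSum B (embed x) i + (v i - l i) * embed x i - v i ≤ t i) ×
        (0# ≤ t i))

    objPL2' : (Fin n → Bool) → (Fin n → Carrier) → Carrier
    objPL2' x t = ∑ n (λ i → t i + (l i + cv i) * embed x i)

    OptPL2' : (Fin n → Bool) → (Fin n → Carrier) → Set (c ⊔ ℓ ⊔ ℓ₂)
    OptPL2' x t = FeasPL2' x t ×
      (∀ x' t' → FeasPL2' x' t' → objPL2' x t ≤ objPL2' x' t')

    EquivPL2 : Set (c ⊔ ℓ ⊔ ℓ₁ ⊔ ℓ₂)
    EquivPL2 =
      (∀ x → OptP x → ∃ λ (p : (Fin n → Bool) × (Fin n → Carrier)) →
          let (x' , y') = p in OptPL2 x' y' × (objPL2 x' y' ≈ objP x)) ×
      (∀ x y → OptPL2 x y → ∃ λ x' → OptP x' × (objP x' ≈ objPL2 x y))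

    EquivPL2' : Set (c ⊔ ℓ ⊔ ℓ₁ ⊔ ℓ₂)
    EquivPL2' =
      (∀ x → OptP x → ∃ λ (p : (Fin n → Bool) × (Fin n → Carrier)) →
          let (x' , t') = p in OptPL2' x' t' × (objPL2' x' t' ≈ objP x)) ×
      (∀ x t → OptPL2' x t → ∃ λ x' → OptP x' × (objP x' ≈ objPL2' x t))

module Submission where

-- For a fixed 0-1 vector x write r_i = ∑_{j≠i} b_ij x_j.  Since b_ii = 0,
-- the objective of (P) is ∑_i (x_i r_i + c_i x_i).  In (PL₂) the variable
-- y_i only occurs in its own two constraints, and because v_i bounds r_i
-- from above when x_i = 0 and l_i bounds it from below when x_i = 1, the
-- least admissible y_i is exactly x_i r_i; in (PL₂') it is
-- t_i = x_i r_i - l_i x_i.  So, for each x ∈ X, the best completion of x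
-- is feasible and has the objective value of x in (P).

open import Data.Nat using (ℕ) renaming (_≤_ to _≤ℕ_)
open import Data.Fin using (Fin; _≟_)
import Data.Fin as Fin
open import Data.Bool using (Bool; true; false; if_then_else_)
open import Data.Product using (_×_; _,_; ∃; proj₁; proj₂)
open import Relation.Nullary.Decidable using (⌊_⌋; yes; no)
open import Relation.Binary using (Rel; IsPartialOrder; IsTotalOrder; Poset)
open import Relation.Binary.PropositionalEquality as ≡ using (_≡_)
open import Defs

module ExactLifting
  {c ℓ₁ ℓ₂ a w ℓX ℓF} {C : Set c} {_≈_ : Rel C ℓ₁} {_≤_ : Rel C ℓ₂}
  (isPartialOrder : IsPartialOrder _≈_ _≤_)
  {A : Set a} {W : Set w}
  (X : A → Set ℓX) (f : A → C) (Feas : A → W → Set ℓF) (g : A → W → C)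
  where

  open IsPartialOrder isPartialOrder

  OptBase : A → Set _
  OptBase x = X x × (∀ x' → X x' → f x ≤ f x')

  OptLifted : A → W → Set _
  OptLifted x y = Feas x y × (∀ x' y' → Feas x' y' → g x y ≤ g x' y')

  Equivalent : Set _
  Equivalent =
    (∀ x → OptBase x → ∃ λ (p : A × W) →
        let (x' , y') = p in OptLifted x' y' × (g x' y' ≈ f x)) ×
    (∀ x y → OptLifted x y → ∃ λ x' → OptBase x' × (f x' ≈ g x y))

  module _
    (completion : A → W)
    (feasible-base : ∀ {x y} → Feas x y → X x)
    (completion-feasible : ∀ {x} → X x → Feas x (completion x))
    (completion-least : ∀ {x y} → Feas x y → g x (completion x) ≤ g x y)
    (completion-value : ∀ {x} → X x → g x (completion x) ≈ f x)
    where

    lifted-bound : ∀ {x y} → Feas x y → f x ≤ g x y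
    lifted-bound {x} F = trans (reflexive (Eq.sym (completion-value (feasible-base F))))
                               (completion-least F)

    equivalent : Equivalent
    equivalent = base⇒lifted , lifted⇒base
      where
      base⇒lifted : ∀ x → OptBase x → ∃ λ (p : A × W) →
        let (x' , y') = p in OptLifted x' y' × (g x' y' ≈ f x)
      base⇒lifted x (Xx , minimal) =
        (x , completion x) ,
        (completion-feasible Xx ,
         λ x' y' F → trans (reflexive (completion-value Xx))
                           (trans (minimal x' (feasible-base F)) (lifted-bound F))) ,
        completion-value Xx

      lifted⇒base : ∀ x y → OptLifted x y → ∃ λ x' → OptBase x' × (f x' ≈ g x y)
      lifted⇒base x y (F , minimal) = x , (Xx , below) , antisym (lifted-bound F) above
        where
        Xx = feasible-base F
        below : ∀ x' → X x' → f x ≤ f x'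
        below x' Xx' = trans (lifted-bound F)
          (trans (minimal x' _ (completion-feasible Xx')) (reflexive (completion-value Xx')))
        above : g x y ≤ f x
        above = trans (minimal x _ (completion-feasible Xx)) (reflexive (completion-value Xx))

module Linearisation {c ℓ₁ ℓ₂} (R : OrderedCommRing c ℓ₁ ℓ₂) where

  open OrderedCommRing R
  open Problem R
  open IsTotalOrder isTotalOrder using (isPartialOrder)
    renaming (reflexive to ≤-reflexive; trans to ≤-trans)

  poset : Poset c ℓ₁ ℓ₂
  poset = record { isPartialOrder = isPartialOrder }

  open import Relation.Binary.Reasoning.PartialOrder poset
  open import Algebra.Properties.Group +-group using (//-rightDividesˡ; //-rightDividesʳ)
  open import Algebra.Properties.Semiring.Sum semiring using (sum; sum-cong-≋; ∑-distrib-+; *-distribˡ-sum)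

  +-mono₂ : ∀ {a a' b b'} → a ≤ a' → b ≤ b' → a + b ≤ a' + b'
  +-mono₂ {a} {a'} {b} {b'} a≤a' b≤b' = begin
    a + b   ≤⟨ +-mono-≤ b a≤a' ⟩
    a' + b  ≈⟨ +-comm a' b ⟩
    b + a'  ≤⟨ +-mono-≤ a' b≤b' ⟩
    b' + a' ≈⟨ +-comm b' a' ⟩
    a' + b' ∎

  ≤⇒-≤0 : ∀ {a b} → a ≤ b → a - b ≤ 0#
  ≤⇒-≤0 {a} {b} a≤b = begin
    a - b ≤⟨ +-mono-≤ (- b) a≤b ⟩
    b - b ≈⟨ -‿inverseʳ b ⟩
    0#    ∎

  ≤⇒0≤- : ∀ {a b} → a ≤ b → 0# ≤ b - a
  ≤⇒0≤- {a} {b} a≤b = begin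
    0#    ≈⟨ -‿inverseʳ a ⟨
    a - a ≤⟨ +-mono-≤ (- a) a≤b ⟩
    b - a ∎

  ∑≡sum : ∀ n (f : Fin n → Carrier) → ∑ n f ≡ sum f
  ∑≡sum ℕ.zero    f = ≡.refl
  ∑≡sum (ℕ.suc n) f = ≡.cong (f Fin.zero +_) (∑≡sum n (λ j → f (Fin.suc j)))

  ∑-cong : ∀ n {f g : Fin n → Carrier} → (∀ i → f i ≈ g i) → ∑ n f ≈ ∑ n g
  ∑-cong n {f} {g} f≈g = begin-equality
    ∑ n f ≡⟨ ∑≡sum n f ⟩
    sum f ≈⟨ sum-cong-≋ f≈g ⟩
    sum g ≡⟨ ∑≡sum n g ⟨
    ∑ n g ∎

  ∑-+ : ∀ n (f g : Fin n → Carrier) → ∑ n (λ i → f i + g i) ≈ ∑ n f + ∑ n g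
  ∑-+ n f g = begin-equality
    ∑ n (λ i → f i + g i) ≡⟨ ∑≡sum n _ ⟩
    sum (λ i → f i + g i) ≈⟨ ∑-distrib-+ f g ⟩
    sum f + sum g         ≡⟨ ≡.cong₂ _+_ (∑≡sum n f) (∑≡sum n g) ⟨
    ∑ n f + ∑ n g         ∎

  ∑-*ˡ : ∀ n a (f : Fin n → Carrier) → ∑ n (λ j → a * f j) ≈ a * ∑ n f
  ∑-*ˡ n a f = begin-equality
    ∑ n (λ j → a * f j) ≡⟨ ∑≡sum n _ ⟩
    sum (λ j → a * f j) ≈⟨ *-distribˡ-sum a f ⟨
    a * sum f           ≡⟨ ≡.cong (a *_) (∑≡sum n f) ⟨
    a * ∑ n f           ∎

  ∑-mono : ∀ n {f g : Fin n → Carrier} → (∀ i → f i ≤ g i) → ∑ n f ≤ ∑ n g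
  ∑-mono ℕ.zero    f≤g = begin 0# ∎
  ∑-mono (ℕ.suc n) f≤g = +-mono₂ (f≤g Fin.zero) (∑-mono n (λ j → f≤g (Fin.suc j)))

  -- Rows of the linearisation.  A single index i is described by the
  -- value b = x_i, the row sum r = ∑_{j≠i} b_ij x_j and the bounds v, l.

  ⟦_⟧ : Bool → Carrier
  ⟦ b ⟧ = if b then 1# else 0#

  -- what the definitions of v and l guarantee about r, depending on x_i
  RowBounds : Bool → (r v l : Carrier) → Set ℓ₂
  RowBounds false r v l = r ≤ v
  RowBounds true  r v l = l ≤ r

  Cut₂ : Bool → (r v l y : Carrier) → Set ℓ₂
  Cut₂ b r v l y = (r + v * ⟦ b ⟧ - v ≤ y) × (l * ⟦ b ⟧ ≤ y)

  Cut₂' : Bool → (r v l t : Carrier) → Set ℓ₂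
  Cut₂' b r v l t = (r + (v - l) * ⟦ b ⟧ - v ≤ t) × (0# ≤ t)

  cut-at-0 : ∀ r w v → r + w * 0# - v ≈ r - v
  cut-at-0 r w v = +-cong (trans (+-cong refl (zeroʳ w)) (+-identityʳ r)) refl

  cut₂-at-1 : ∀ r v → r + v * 1# - v ≈ 1# * r
  cut₂-at-1 r v = begin-equality
    r + v * 1# - v ≈⟨ +-cong (+-cong refl (*-identityʳ v)) refl ⟩
    r + v - v      ≈⟨ //-rightDividesʳ v r ⟩
    r              ≈⟨ *-identityˡ r ⟨
    1# * r         ∎

  cut₂'-at-1 : ∀ r v l → r + (v - l) * 1# - v ≈ 1# * r - l * 1#
  cut₂'-at-1 r v l = begin-equality
    r + (v - l) * 1# - v ≈⟨ +-cong (+-cong refl (*-identityʳ (v - l))) refl ⟩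
    r + (v - l) - v      ≈⟨ +-cong (+-cong refl (+-comm v (- l))) refl ⟩
    r + (- l + v) - v    ≈⟨ +-cong (+-assoc r (- l) v) refl ⟨
    (r - l) + v - v      ≈⟨ //-rightDividesʳ v (r - l) ⟩
    r - l                ≈⟨ +-cong (*-identityˡ r) (-‿cong (*-identityʳ l)) ⟨
    1# * r - l * 1#      ∎

  vanish-at-0 : ∀ r l → 0# * r - l * 0# ≈ 0#
  vanish-at-0 r l = trans (+-cong (zeroˡ r) (-‿cong (zeroʳ l))) (-‿inverseʳ 0#)

  cut₂-tight : ∀ b {r v l} → RowBounds b r v l → Cut₂ b r v l (⟦ b ⟧ * r)
  cut₂-tight true {r} {v} {l} l≤r =
      ≤-reflexive (cut₂-at-1 r v)
    , (begin l * 1# ≈⟨ *-identityʳ l ⟩ l ≤⟨ l≤r ⟩ r ≈⟨ *-identityˡ r ⟨ 1# * r ∎)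
  cut₂-tight false {r} {v} {l} r≤v =
      (begin
        r + v * 0# - v ≈⟨ cut-at-0 r v v ⟩
        r - v          ≤⟨ ≤⇒-≤0 r≤v ⟩
        0#             ≈⟨ zeroˡ r ⟨
        0# * r         ∎)
    , ≤-reflexive (trans (zeroʳ l) (sym (zeroˡ r)))

  cut₂-least : ∀ b {r v l y} → Cut₂ b r v l y → ⟦ b ⟧ * r ≤ y
  cut₂-least true  {r} {v}     (r≤y , _)  = ≤-trans (≤-reflexive (sym (cut₂-at-1 r v))) r≤y
  cut₂-least false {r} {l = l} (_ , 0≤y) = ≤-trans (≤-reflexive (trans (zeroˡ r) (sym (zeroʳ l)))) 0≤y

  cut₂'-tight : ∀ b {r v l} → RowBounds b r v l → Cut₂' b r v l (⟦ b ⟧ * r - l * ⟦ b ⟧)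
  cut₂'-tight true {r} {v} {l} l≤r =
      ≤-reflexive (cut₂'-at-1 r v l)
    , ≤-trans (≤⇒0≤- l≤r) (≤-reflexive (+-cong (sym (*-identityˡ r)) (-‿cong (sym (*-identityʳ l)))))
  cut₂'-tight false {r} {v} {l} r≤v =
      (begin
        r + (v - l) * 0# - v ≈⟨ cut-at-0 r (v - l) v ⟩
        r - v                ≤⟨ ≤⇒-≤0 r≤v ⟩
        0#                   ≈⟨ vanish-at-0 r l ⟨
        0# * r - l * 0#      ∎)
    , ≤-reflexive (sym (vanish-at-0 r l))

  cut₂'-least : ∀ b {r v l t} → Cut₂' b r v l t → ⟦ b ⟧ * r - l * ⟦ b ⟧ ≤ t
  cut₂'-least true  {r} {v} {l} (r-l≤t , _) = ≤-trans (≤-reflexive (sym (cut₂'-at-1 r v l))) r-l≤t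
  cut₂'-least false {r} {l = l} (_ , 0≤t)  = ≤-trans (≤-reflexive (vanish-at-0 r l)) 0≤t

  quadratic-row : ∀ {n} (B : Fin n → Fin n → Carrier) → (∀ i → B i i ≈ 0#) →
    ∀ (e : Fin n → Carrier) i → ∑ n (λ j → e i * B i j * e j) ≈ e i * rowSum B e i
  quadratic-row {n} B Bii≈0 e i = trans (∑-cong n term) (∑-*ˡ n (e i) _)
    where
    term : ∀ j → e i * B i j * e j ≈ e i * (if ⌊ j ≟ i ⌋ then 0# else B i j * e j)
    term j with j ≟ i
    ... | yes ≡.refl = trans (*-assoc (e i) (B i i) (e i))
                             (*-cong refl (trans (*-cong (Bii≈0 i) refl) (zeroˡ (e i))))
    ... | no _       = *-assoc (e i) (B i j) (e j)

  quadratic-objective : ∀ {n} (B : Fin n → Fin n → Carrier) → (∀ i → B i i ≈ 0#) →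
    ∀ (cv e : Fin n → Carrier) →
    ∑ n (λ i → e i * rowSum B e i + cv i * e i)
      ≈ ∑ n (λ i → ∑ n (λ j → e i * B i j * e j)) + ∑ n (λ i → cv i * e i)
  quadratic-objective {n} B Bii≈0 cv e = begin-equality
    ∑ n (λ i → e i * rowSum B e i + cv i * e i)
      ≈⟨ ∑-+ n _ _ ⟩
    ∑ n (λ i → e i * rowSum B e i) + ∑ n (λ i → cv i * e i)
      ≈⟨ +-cong (∑-cong n (λ i → sym (quadratic-row B Bii≈0 e i))) refl ⟩
    ∑ n (λ i → ∑ n (λ j → e i * B i j * e j)) + ∑ n (λ i → cv i * e i) ∎

  shifted-summand : ∀ e r l d → (e * r - l * e) + (l + d) * e ≈ e * r + d * e
  shifted-summand e r l d = begin-equality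
    (e * r - l * e) + (l + d) * e     ≈⟨ +-cong refl (distribʳ e l d) ⟩
    (e * r - l * e) + (l * e + d * e) ≈⟨ +-assoc (e * r - l * e) (l * e) (d * e) ⟨
    (e * r - l * e) + l * e + d * e   ≈⟨ +-cong (//-rightDividesˡ (l * e) (e * r)) refl ⟩
    e * r + d * e                     ∎

  module _ {n ℓ ℓ'} (B : Fin n → Fin n → Carrier) (Bii≈0 : ∀ i → B i i ≈ 0#)
    (cv : Fin n → Carrier) (X : (Fin n → Bool) → Set ℓ)
    (Xbar : (Fin n → Carrier) → Set ℓ') (X⊆Xbar : ∀ x → X x → Xbar (embed x))
    (v l : Fin n → Carrier)
    (v-max : ∀ i → IsMaxRow Xbar B i (v i)) (l-min : ∀ i → IsMinRow Xbar B i (l i))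
    where

    open Instance B cv X v l

    row : (Fin n → Bool) → Fin n → Carrier
    row x = rowSum B (embed x)

    row-bounds : ∀ {x} → X x → ∀ i → RowBounds (x i) (row x i) (v i) (l i)
    row-bounds {x} Xx i with x i in xi
    ... | true  = proj₂ (l-min i) (embed x) (X⊆Xbar x Xx) (reflexive (≡.cong ⟦_⟧ xi))
    ... | false = proj₂ (v-max i) (embed x) (X⊆Xbar x Xx) (reflexive (≡.cong ⟦_⟧ xi))

    equivalent₂ : EquivPL2
    equivalent₂ = ExactLifting.equivalent isPartialOrder X objP FeasPL2 objPL2
      (λ x i → embed x i * row x i)
      proj₁
      (λ {x} Xx → Xx , λ i → cut₂-tight (x i) (row-bounds Xx i))
      (λ {x} (_ , cuts) → ∑-mono n (λ i → +-mono-≤ (cv i * embed x i) (cut₂-least (x i) (cuts i))))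
      (λ {x} _ → quadratic-objective B Bii≈0 cv (embed x))

    equivalent₂' : EquivPL2'
    equivalent₂' = ExactLifting.equivalent isPartialOrder X objP FeasPL2' objPL2'
      (λ x i → embed x i * row x i - l i * embed x i)
      proj₁
      (λ {x} Xx → Xx , λ i → cut₂'-tight (x i) (row-bounds Xx i))
      (λ {x} (_ , cuts) →
         ∑-mono n (λ i → +-mono-≤ ((l i + cv i) * embed x i) (cut₂'-least (x i) (cuts i))))
      (λ {x} _ → trans (∑-cong n (λ i → shifted-summand (embed x i) (row x i) (l i) (cv i)))
                       (quadratic-objective B Bii≈0 cv (embed x)))

-- Theorem 3: (P) is equivalent to both (PL₂) and (PL₂').
theorem3 : ∀ {c ℓ₁ ℓ₂ ℓ ℓ'} (R : OrderedCommRing c ℓ₁ ℓ₂) →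
  let open OrderedCommRing R
      open Problem R
  in (n : ℕ) → 1 ≤ℕ n →
     (B : Fin n → Fin n → Carrier) →
     (∀ i j → 0# ≤ B i j) → (∀ i → B i i ≈ 0#) →
     (cv : Fin n → Carrier) →
     (X : (Fin n → Bool) → Set ℓ) →
     (Xbar : (Fin n → Carrier) → Set ℓ') →
     (∀ x → X x → Xbar (embed x)) →
     (∀ x → Xbar x → InUnitBox x) →
     (v l : Fin n → Carrier) →
     (∀ i → IsMaxRow Xbar B i (v i)) →
     (∀ i → IsMinRow Xbar B i (l i)) →
     Instance.EquivPL2 B cv X v l × Instance.EquivPL2' B cv X v l
theorem3 R n _ B _ Bii≈0 cv X Xbar X⊆Xbar _ v l v-max l-min =
  equivalent₂ B Bii≈0 cv X Xbar X⊆Xbar v l v-max l-min ,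
  equivalent₂' B Bii≈0 cv X Xbar X⊆Xbar v l v-max l-min
  where open Linearisation R
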